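{- Let $M$ be a monad on $\mathbf{Set}$ and $(\mathcal{A},\cdot)$ a monadic applicative structure over $M$. Then $\mathcal{A}$ admits the structure of a monadic combinatory algebra over $M$ if and only if $\mathcal{A}$, with application morphism $\circledast:=\cdot$, is a combinatory object in the Freyd category $\langle\mathbf{Set},\mathbf{Set}_M,J_M\rangle$, i.e. if and only if every positive $\mathcal{A}$-monomial is $\mathcal{A}$-computable.
   Context: $(M,\eta,\mu)$ is a monad on $\mathbf{Set}$; write $\mathrm{let}\ x\Leftarrow m\ \mathrm{in}\ g(x):=\mu(Mg(m))$. An MAS over $M$ is a set $\mathcal{A}$ with a map $\cdot:\mathcal{A}\times\mathcal{A}\to M\mathcal{A}$. MCA: expressions $e::= i\in\mathbb{N}\mid c\in\mathcal{A}\mid e\bullet e$, $E_n(\mathcal{A})$ those with all variables $<n$; substitution $0[c]=c$, $(i+1)[c]=i$, $c'[c]=c'$, $(e_1\bullet e_2)[c]=e_1[c]\bullet e_2[c]$; evaluation $\nu(c)=\eta(c)$, $\nu(e_f\bullet e_a)=\mathrm{let}\ c_f\Leftarrow\nu(e_f)\ \mathrm{in}\ \mathrm{let}\ c_a\Leftarrow\nu(e_a)\ \mathrm{in}\ c_f\cdot c_a$; an MCA is an MAS with codes $\langle\lambda^n.e\rangle\in\mathcal{A}$ ($e\in E_{n+1}(\mathcal{A})$) with $\langle\lambda^{n+1}.e\rangle\cdot c=\eta(\langle\lambda^n.e[c]\rangle)$ and $\langle\lambda^0.e\rangle\cdot c=\nu(e[c])$. The Freyd category $\langle\mathbf{Set},\mathbf{Set}_M,J_M\rangle$: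 $\mathbf{Set}_M$ is the Kleisli category (morphisms $A\to B$ are functions $A\to MB$), $J_M(f)=\eta\circ f$, and the premonoidal actions are $(f\ltimes B)(x,y)=\mathrm{let}\ x'\Leftarrow f(x)\ \mathrm{in}\ \eta(x',y)$, $(A\rtimes f)(x,y)=\mathrm{let}\ y'\Leftarrow f(y)\ \mathrm{in}\ \eta(x,y')$, structural isomorphisms being those of $\mathbf{Set}$ composed with $\eta$. Concretely, global elements $1\to\mathcal{A}$ in $\mathbf{Set}$ are elements of $\mathcal{A}$. Iterated application: for $a\in\mathcal{A}$ and $x_1,\dots,x_m\in\mathcal{A}$, $\circledast^0(a)=\eta(a)$ and $\circledast^{m+1}(a,x_1,\dots,x_{m+1})=\mathrm{let}\ b\Leftarrow a\cdot x_1\ \mathrm{in}\ \circledast^m(b,x_2,\dots,x_{m+1})$. $\mathcal{A}$-computable: for $n>0$, a Kleisli map $f:\mathcal{A}^n\to M\mathcal{A}$ is $\mathcal{A}$-computable if for every $k\in\{0,\dots,n-1\}$ and all $c_1,\dots,c_k\in\mathcal{A}$ there is a code $\ulcorner f(c_1,\dots,c_k)\urcorner\in\mathcal{A}$ (written $\ulcorner f\urcorner$ when $k=0$) such that for all $x_{k+1},\dots,x_n\in\mathcal{A}$, $\circledast^{n-k}(\ulcorner f(c_1,\dots,c_k)\urcorner,x_{k+1},\dots,x_n)=f(c_1,\dots,c_k,x_{k+1},\dots,x_n)$, and $\circledast^k(\ulcorner f\urcorner,c_1,\dots,c_k)=\eta(\ulcorner f(c_1,\dots,c_k)\urcorner)$.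 $\mathcal{A}$-monomials: for $p::= i\in\mathbb{N}\mid c\in\mathcal{A}\mid p\bullet p$ with all variables $<n$, define $[\![p]\!]_n:\mathcal{A}^n\to M\mathcal{A}$ by $[\![i]\!]_n(\vec x)=\eta(x_{i+1})$, $[\![c]\!]_n(\vec x)=\eta(c)$, $[\![p_f\bullet p_a]\!]_n(\vec x)=\mathrm{let}\ f\Leftarrow[\![p_f]\!]_n(\vec x)\ \mathrm{in}\ \mathrm{let}\ a\Leftarrow[\![p_a]\!]_n(\vec x)\ \mathrm{in}\ f\cdot a$. A positive $\mathcal{A}$-monomial is a map of the form $[\![p]\!]_n$ with $n>0$. A combinatory object is an applicative object all of whose positive monomials are $\mathcal{A}$-computable. -}

module Defs where

open import Data.Nat using (ℕ; zero; suc; _+_)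
open import Data.Fin using (Fin) renaming (zero to fzero; suc to fsuc)
open import Data.Vec using (Vec; []; _∷_; lookup; _++_; cast)
open import Data.Product using (Σ; _×_)
open import Relation.Binary.PropositionalEquality using (_≡_)

-- A monad on Set, presented as a Kleisli triple (η, bind) with the monad laws.
-- bind m g corresponds to  let x ⇐ m in g(x) := μ(M g (m)).
record Monad : Set₁ where
  field
    M    : Set → Set
    η    : {X : Set} → X → M X
    bind : {X Y : Set} → M X → (X → M Y) → M Y
    left-id  : {X Y : Set} (x : X) (g : X → M Y) → bind (η x) g ≡ g x
    right-id : {X : Set} (m : M X) → bind m η ≡ m
    assoc    : {X Y Z : Set} (m : M X) (g : X → M Y) (h : Y → M Z) →
               bind (bind m g) h ≡ bind m (λ x → bind (g x) h)

module _ (Mon : Monad) (A : Set) (_·_ : A → A → Monad.M Mon A) where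
  open Monad Mon

  data Exp (n : ℕ) : Set where
    var   : Fin n → Exp n
    const : A → Exp n
    _•_   : Exp n → Exp n → Exp n

  subst0 : {n : ℕ} → Exp (suc n) → A → Exp n
  subst0 (var fzero)    c = const c
  subst0 (var (fsuc i)) c = var i
  subst0 (const c')     c = const c'
  subst0 (e₁ • e₂)      c = subst0 e₁ c • subst0 e₂ c

  ν : Exp 0 → M A
  ν (var ())
  ν (const c) = η c
  ν (ef • ea) = bind (ν ef) (λ cf → bind (ν ea) (λ ca → cf · ca))

  -- MCA structure: codes ⟨λ^n.e⟩ for e ∈ E_{n+1}
  IsMCA : (code : (n : ℕ) → Exp (suc n) → A) → Set
  IsMCA code =
    ((n : ℕ) (e : Exp (suc (suc n))) (c : A) → code (suc n) e · c ≡ η (code n (subst0 e c)))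
    × ((e : Exp 1) (c : A) → code 0 e · c ≡ ν (subst0 e c))

  MCAStructure : Set
  MCAStructure = Σ ((n : ℕ) → Exp (suc n) → A) IsMCA

  ⊛ : {m : ℕ} → A → Vec A m → M A
  ⊛ a []       = η a
  ⊛ a (x ∷ xs) = bind (a · x) (λ b → ⊛ b xs)

  -- A-computability of a Kleisli map f : A^n → M A (n > 0).
  -- k ranges over 0..n-1, expressed as n ≡ k + suc j.
  Computable : (n : ℕ) → (Vec A n → M A) → Set
  Computable n f =
    Σ A λ fcode →
      ((xs : Vec A n) → ⊛ fcode xs ≡ f xs)
      × ((k j : ℕ) (eq : k + suc j ≡ n) (cs : Vec A k) →
          Σ A λ code →
            ((xs : Vec A (suc j)) → ⊛ code xs ≡ f (cast eq (cs ++ xs)))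
            × (⊛ fcode cs ≡ η code))

  ⟦_⟧ : {n : ℕ} → Exp n → Vec A n → M A
  ⟦ var i ⟧   xs = η (lookup xs i)
  ⟦ const c ⟧ xs = η c
  ⟦ pf • pa ⟧ xs = bind (⟦ pf ⟧ xs) (λ f → bind (⟦ pa ⟧ xs) (λ a → f · a))

  CombinatoryObject : Set
  CombinatoryObject = (m : ℕ) (p : Exp (suc m)) → Computable (suc m) ⟦ p ⟧

{-# OPTIONS --safe #-}
module Submission where

-- An MCA is a combinatory object because its codes ⟨λᵐ.p⟩ compute the monomial p one
-- argument at a time, and each partial application is pure, returning the code ⟨λᵐ⁻¹.p[c]⟩.
-- Conversely, computability of the monomials x₀ and x₀x₂(x₁x₂) yields combinators K and S
-- whose partial applications are pure: K·a = η(K₁ a), S·a = η(S₁ a), S₁ a·b = η(S₂ a b).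
-- Bracket abstraction into terms built from K₁ and S₂ therefore abstracts to values, not
-- computations, and iterating it over all variables gives codes satisfying the MCA laws.

open import Data.Empty using (⊥-elim)
open import Data.Fin using (Fin; #_) renaming (zero to fzero; suc to fsuc)
open import Data.Maybe using (Maybe; just; nothing)
import Data.Maybe as Maybe
open import Data.Nat using (ℕ; zero; suc; pred; _+_)
open import Data.Nat.Properties using (m+1+n≢0)
open import Data.Product using (Σ; _×_; _,_; proj₁; proj₂)
open import Data.Vec using (Vec; []; _∷_; _++_; cast)
open import Data.Vec.Properties using (cast-is-id)
open import Function.Base using (_∘_)
open import Function.Bundles using (_⇔_; mk⇔)
open import Relation.Binary.PropositionalEquality
  using (_≡_; refl; sym; trans; cong; cong₂; module ≡-Reasoning)

open import Defs hiding (subst0; ν; ⊛; ⟦_⟧; Computable)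
import Defs

tryLower : {m : ℕ} → Fin (suc m) → Maybe (Fin m)
tryLower {zero}  fzero    = nothing
tryLower {suc m} fzero    = just fzero
tryLower {suc m} (fsuc i) = Maybe.map fsuc (tryLower i)

module _ (Mon : Monad) (A : Set) (_·_ : A → A → Monad.M Mon A) where
  open Monad Mon
  open ≡-Reasoning

  E : ℕ → Set
  E = Exp Mon A _·_

  _[_] : {n : ℕ} → E (suc n) → A → E n
  _[_] = Defs.subst0 Mon A _·_

  ν : E 0 → M A
  ν = Defs.ν Mon A _·_

  ⟦_⟧ : {n : ℕ} → E n → Vec A n → M A
  ⟦_⟧ = Defs.⟦_⟧ Mon A _·_

  ⊛ : {m : ℕ} → A → Vec A m → M A
  ⊛ = Defs.⊛ Mon A _·_

  Computable : (n : ℕ) → (Vec A n → M A) → Set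
  Computable = Defs.Computable Mon A _·_

  _⊙_ : M A → M A → M A
  mf ⊙ ma = bind mf (λ f → bind ma (f ·_))

  η-⊙-η : (f a : A) → η f ⊙ η a ≡ f · a
  η-⊙-η f a = trans (left-id f _) (left-id a (f ·_))

  ⊛-singleton : (a x : A) → ⊛ a (x ∷ []) ≡ a · x
  ⊛-singleton a x = right-id (a · x)

  ⊛-∷-pure : {m : ℕ} {a b x : A} (xs : Vec A m) → a · x ≡ η b → ⊛ a (x ∷ xs) ≡ ⊛ b xs
  ⊛-∷-pure {b = b} xs ax≡ηb =
    trans (cong (λ m → bind m (λ b′ → ⊛ b′ xs)) ax≡ηb) (left-id b _)

  ⟦⟧-[] : {n : ℕ} (e : E (suc n)) (c : A) (xs : Vec A n) → ⟦ e [ c ] ⟧ xs ≡ ⟦ e ⟧ (c ∷ xs)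
  ⟦⟧-[] (var fzero)    c xs = refl
  ⟦⟧-[] (var (fsuc i)) c xs = refl
  ⟦⟧-[] (const a)      c xs = refl
  ⟦⟧-[] (e₁ • e₂)      c xs = cong₂ _⊙_ (⟦⟧-[] e₁ c xs) (⟦⟧-[] e₂ c xs)

  ν≡⟦⟧[] : (e : E 0) → ν e ≡ ⟦ e ⟧ []
  ν≡⟦⟧[] (var ())
  ν≡⟦⟧[] (const a) = refl
  ν≡⟦⟧[] (e₁ • e₂) = cong₂ _⊙_ (ν≡⟦⟧[] e₁) (ν≡⟦⟧[] e₂)

  mca⇒combinatoryObject : MCAStructure Mon A _·_ → CombinatoryObject Mon A _·_
  mca⇒combinatoryObject (code , code-suc-β , code-zero-β) m p =
    code m p , code-⊛ m p , λ k j eq cs → applyPrefix k j m eq p cs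
    where
    code-⊛ : (m : ℕ) (p : E (suc m)) (xs : Vec A (suc m)) → ⊛ (code m p) xs ≡ ⟦ p ⟧ xs
    code-⊛ zero p (x ∷ []) = begin
      ⊛ (code zero p) (x ∷ [])  ≡⟨ ⊛-singleton _ x ⟩
      code zero p · x           ≡⟨ code-zero-β p x ⟩
      ν (p [ x ])               ≡⟨ ν≡⟦⟧[] (p [ x ]) ⟩
      ⟦ p [ x ] ⟧ []            ≡⟨ ⟦⟧-[] p x [] ⟩
      ⟦ p ⟧ (x ∷ [])            ∎
    code-⊛ (suc m) p (x ∷ xs) = begin
      ⊛ (code (suc m) p) (x ∷ xs)  ≡⟨ ⊛-∷-pure xs (code-suc-β m p x) ⟩
      ⊛ (code m (p [ x ])) xs      ≡⟨ code-⊛ m (p [ x ]) xs ⟩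
      ⟦ p [ x ] ⟧ xs               ≡⟨ ⟦⟧-[] p x xs ⟩
      ⟦ p ⟧ (x ∷ xs)               ∎

    applyPrefix : (k j m : ℕ) (eq : k + suc j ≡ suc m) (p : E (suc m)) (cs : Vec A k) →
      Σ A λ d → ((xs : Vec A (suc j)) → ⊛ d xs ≡ ⟦ p ⟧ (cast eq (cs ++ xs)))
              × (⊛ (code m p) cs ≡ η d)
    applyPrefix zero j m refl p [] =
      code m p , (λ xs → trans (code-⊛ m p xs) (cong ⟦ p ⟧ (sym (cast-is-id refl xs)))) , refl
    applyPrefix (suc k) j zero eq p (c ∷ cs) = ⊥-elim (m+1+n≢0 k (cong pred eq))
    applyPrefix (suc k) j (suc m) eq p (c ∷ cs)
      with d , d-⊛ , code-⊛-cs ← applyPrefix k j m (cong pred eq) (p [ c ]) cs =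
      d , (λ xs → trans (d-⊛ xs) (⟦⟧-[] p c _)) , trans (⊛-∷-pure cs (code-suc-β m p c)) code-⊛-cs

  record SKIBasis : Set where
    field
      K    : A
      K₁   : A → A
      S    : A
      S₁   : A → A
      S₂   : A → A → A
      K-β  : (a : A) → K · a ≡ η (K₁ a)
      K₁-β : (a b : A) → K₁ a · b ≡ η a
      S-β  : (a : A) → S · a ≡ η (S₁ a)
      S₁-β : (a b : A) → S₁ a · b ≡ η (S₂ a b)
      S₂-β : (a b c : A) → S₂ a b · c ≡ (a · c) ⊙ (b · c)

  module _ {n : ℕ} {f : Vec A n → M A} (C : Computable n f) where
    code : A
    code = proj₁ C

    module _ (k j : ℕ) (eq : k + suc j ≡ n) (cs : Vec A k) where
      partialCode : A
      partialCode = proj₁ (proj₂ (proj₂ C) k j eq cs)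

      partialCode-⊛ : (xs : Vec A (suc j)) → ⊛ partialCode xs ≡ f (cast eq (cs ++ xs))
      partialCode-⊛ = proj₁ (proj₂ (proj₂ (proj₂ C) k j eq cs))

      ⊛-partialCode : ⊛ code cs ≡ η partialCode
      ⊛-partialCode = proj₂ (proj₂ (proj₂ (proj₂ C) k j eq cs))

  combinatoryObject⇒SKIBasis : CombinatoryObject Mon A _·_ → SKIBasis
  combinatoryObject⇒SKIBasis CO = record
    { K    = code K-computable
    ; K₁   = K₁
    ; S    = code S-computable
    ; S₁   = S₁
    ; S₂   = S₂
    ; K-β  = λ a → trans (sym (⊛-singleton _ a)) (⊛-partialCode K-computable 1 0 refl (a ∷ []))
    ; K₁-β = λ a b → trans (sym (⊛-singleton _ b))
                           (partialCode-⊛ K-computable 1 0 refl (a ∷ []) (b ∷ []))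
    ; S-β  = S-β
    ; S₁-β = S₁-β
    ; S₂-β = S₂-β
    }
    where
    K-computable : Computable 2 ⟦ var (# 0) ⟧
    K-computable = CO 1 (var (# 0))

    S-monomial : E 3
    S-monomial = (var (# 0) • var (# 2)) • (var (# 1) • var (# 2))

    S-computable : Computable 3 ⟦ S-monomial ⟧
    S-computable = CO 2 S-monomial

    K₁ : A → A
    K₁ a = partialCode K-computable 1 0 refl (a ∷ [])

    S₁ : A → A
    S₁ a = partialCode S-computable 1 1 refl (a ∷ [])

    S₂ : A → A → A
    S₂ a b = partialCode S-computable 2 0 refl (a ∷ b ∷ [])

    S-β : (a : A) → code S-computable · a ≡ η (S₁ a)
    S-β a = trans (sym (⊛-singleton _ a)) (⊛-partialCode S-computable 1 1 refl (a ∷ []))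

    S₁-β : (a b : A) → S₁ a · b ≡ η (S₂ a b)
    S₁-β a b = begin
      S₁ a · b                            ≡⟨ ⊛-singleton _ b ⟨
      ⊛ (S₁ a) (b ∷ [])                   ≡⟨ ⊛-∷-pure (b ∷ []) (S-β a) ⟨
      ⊛ (code S-computable) (a ∷ b ∷ [])  ≡⟨ ⊛-partialCode S-computable 2 0 refl (a ∷ b ∷ []) ⟩
      η (S₂ a b)                          ∎

    S₂-β : (a b c : A) → S₂ a b · c ≡ (a · c) ⊙ (b · c)
    S₂-β a b c = begin
      S₂ a b · c                 ≡⟨ ⊛-singleton _ c ⟨
      ⊛ (S₂ a b) (c ∷ [])        ≡⟨ partialCode-⊛ S-computable 2 0 refl (a ∷ b ∷ []) (c ∷ []) ⟩
      (η a ⊙ η c) ⊙ (η b ⊙ η c)  ≡⟨ cong₂ _⊙_ (η-⊙-η a c) (η-⊙-η b c) ⟩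
      (a · c) ⊙ (b · c)          ∎

  data Term (n : ℕ) : Set where
    var    : Fin n → Term n
    con    : A → Term n
    K⟨_⟩   : Term n → Term n
    S⟨_,_⟩ : Term n → Term n → Term n

  _[_]ᵗ : {n : ℕ} → Term (suc n) → A → Term n
  var fzero    [ c ]ᵗ = con c
  var (fsuc i) [ c ]ᵗ = var i
  con a        [ c ]ᵗ = con a
  K⟨ t ⟩       [ c ]ᵗ = K⟨ t [ c ]ᵗ ⟩
  S⟨ t , u ⟩   [ c ]ᵗ = S⟨ t [ c ]ᵗ , u [ c ]ᵗ ⟩

  module BracketAbstraction (B : SKIBasis) where
    open SKIBasis B

    S₂-β-pure : {a b c a′ b′ : A} → a · c ≡ η a′ → b · c ≡ η b′ → S₂ a b · c ≡ a′ · b′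
    S₂-β-pure {a} {b} {c} {a′} {b′} ac≡ηa′ bc≡ηb′ = begin
      S₂ a b · c          ≡⟨ S₂-β a b c ⟩
      (a · c) ⊙ (b · c)   ≡⟨ cong₂ _⊙_ ac≡ηa′ bc≡ηb′ ⟩
      η a′ ⊙ η b′         ≡⟨ η-⊙-η a′ b′ ⟩
      a′ · b′             ∎

    I : A
    I = S₂ K K

    I-β : (c : A) → I · c ≡ η c
    I-β c = trans (S₂-β-pure (K-β c) (K-β c)) (K₁-β c (K₁ c))

    value : Term 0 → A
    value (var ())
    value (con a)      = a
    value K⟨ t ⟩       = K₁ (value t)
    value S⟨ t , u ⟩   = S₂ (value t) (value u)

    ƛvar : {m : ℕ} → Maybe (Fin m) → Term m
    ƛvar nothing  = con I
    ƛvar (just j) = K⟨ var j ⟩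

    -- ƛ binds the highest variable: it is the innermost binder of ⟨λⁿ.e⟩, as e[c]
    -- substitutes variable 0.
    ƛ : {m : ℕ} → Term (suc m) → Term m
    ƛ (var i)      = ƛvar (tryLower i)
    ƛ (con a)      = K⟨ con a ⟩
    ƛ K⟨ t ⟩       = S⟨ K⟨ con K ⟩ , ƛ t ⟩
    ƛ S⟨ t , u ⟩   = S⟨ S⟨ K⟨ con S ⟩ , ƛ t ⟩ , ƛ u ⟩

    ƛᵉ : {m : ℕ} → E (suc m) → Term m
    ƛᵉ (var i)   = ƛ (var i)
    ƛᵉ (const a) = ƛ (con a)
    ƛᵉ (e₁ • e₂) = S⟨ ƛᵉ e₁ , ƛᵉ e₂ ⟩

    ƛvar-[] : {m : ℕ} (x : Maybe (Fin m)) (c : A) → ƛvar (Maybe.map fsuc x) [ c ]ᵗ ≡ ƛvar x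
    ƛvar-[] nothing  c = refl
    ƛvar-[] (just j) c = refl

    ƛ-[] : {m : ℕ} (t : Term (suc (suc m))) (c : A) → ƛ t [ c ]ᵗ ≡ ƛ (t [ c ]ᵗ)
    ƛ-[] (var fzero)    c = refl
    ƛ-[] (var (fsuc i)) c = ƛvar-[] (tryLower i) c
    ƛ-[] (con a)        c = refl
    ƛ-[] K⟨ t ⟩         c = cong (λ t′ → S⟨ K⟨ con K ⟩ , t′ ⟩) (ƛ-[] t c)
    ƛ-[] S⟨ t , u ⟩     c =
      cong₂ (λ t′ u′ → S⟨ S⟨ K⟨ con S ⟩ , t′ ⟩ , u′ ⟩) (ƛ-[] t c) (ƛ-[] u c)

    ƛᵉ-[] : {m : ℕ} (e : E (suc (suc m))) (c : A) → ƛᵉ e [ c ]ᵗ ≡ ƛᵉ (e [ c ])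
    ƛᵉ-[] (var fzero)    c = refl
    ƛᵉ-[] (var (fsuc i)) c = ƛ-[] (var (fsuc i)) c
    ƛᵉ-[] (const a)      c = refl
    ƛᵉ-[] (e₁ • e₂)      c = cong₂ S⟨_,_⟩ (ƛᵉ-[] e₁ c) (ƛᵉ-[] e₂ c)

    ƛ-β : (t : Term 1) (c : A) → value (ƛ t) · c ≡ η (value (t [ c ]ᵗ))
    ƛ-β (var fzero)  c = I-β c
    ƛ-β (con a)      c = K₁-β a c
    ƛ-β K⟨ t ⟩       c = trans (S₂-β-pure (K₁-β K c) (ƛ-β t c)) (K-β _)
    ƛ-β S⟨ t , u ⟩   c =
      trans (S₂-β-pure (trans (S₂-β-pure (K₁-β S c) (ƛ-β t c)) (S-β _)) (ƛ-β u c)) (S₁-β _ _)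

    ƛᵉ-β : (e : E 1) (c : A) → value (ƛᵉ e) · c ≡ ν (e [ c ])
    ƛᵉ-β (var fzero) c = I-β c
    ƛᵉ-β (const a)   c = K₁-β a c
    ƛᵉ-β (e₁ • e₂)   c = trans (S₂-β _ _ c) (cong₂ _⊙_ (ƛᵉ-β e₁ c) (ƛᵉ-β e₂ c))

    close : (n : ℕ) → Term n → A
    close zero    t = value t
    close (suc n) t = close n (ƛ t)

    close-β : (n : ℕ) (t : Term (suc n)) (c : A) → close (suc n) t · c ≡ η (close n (t [ c ]ᵗ))
    close-β zero    t c = ƛ-β t c
    close-β (suc n) t c = trans (close-β n (ƛ t) c) (cong (η ∘ close n) (ƛ-[] t c))

    mcaStructure : MCAStructure Mon A _·_
    mcaStructure =
      (λ n e → close n (ƛᵉ e)) ,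
      (λ n e c → trans (close-β n (ƛᵉ e) c) (cong (η ∘ close n) (ƛᵉ-[] e c))) ,
      ƛᵉ-β

theorem1 : (Mon : Monad) (A : Set) (_·_ : A → A → Monad.M Mon A) →
           MCAStructure Mon A _·_ ⇔ CombinatoryObject Mon A _·_
theorem1 Mon A _·_ =
  mk⇔ (mca⇒combinatoryObject Mon A _·_)
      (BracketAbstraction.mcaStructure Mon A _·_ ∘ combinatoryObject⇒SKIBasis Mon A _·_)
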